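{- For an integer $k\ge1$, define the $k$-Fibonacci sequence by $F_0(k)=0$, $F_1(k)=1$, $F_n(k)=kF_{n-1}(k)+F_{n-2}(k)$ for $n\ge2$. For $n\ge2$ let $I_{k,n}(t)=\#(t\mathcal{T}\cap\mathbb{Z}^2)$ be the Ehrhart quasipolynomial of the triangle $\mathcal{T}$ with vertices $(0,0)$, $\left(\frac{F_{n-1}(k)}{F_n(k)},0\right)$, $\left(0,\frac{F_n(k)}{F_{n-1}(k)}\right)$. Then for every $k\ge1$ and every even integer $n\ge2$, $F_n(k)$ is a common quasi-period of $I_{k,n}(t)$ and $I_{k,n+1}(t)$.
   Context: For a rational polytope, the Ehrhart function (for positive integers $t$) is a quasipolynomial $\sum_i c_i(t)t^i$ with each $c_i$ periodic in $t$; an integer $N$ is a quasi-period of it if $N$ is a common period of all coefficient functions $c_i$. -}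

module Defs where

open import Data.Nat as ℕ using (ℕ; zero; suc; _≤?_)
open import Data.List using (List; upTo; filter; length; concatMap; map)
open import Data.Product using (_×_; _,_; proj₁; proj₂)
open import Data.Integer using (+_)
open import Data.Rational using (ℚ; _/_; _+_; _*_)
open import Relation.Binary.PropositionalEquality using (_≡_)

kFib : ℕ → ℕ → ℕ
kFib k zero = 0
kFib k (suc zero) = 1
kFib k (suc (suc n)) = k ℕ.* kFib k (suc n) ℕ.+ kFib k n

-- Lattice points of t·T, T = conv{(0,0), (B/A,0), (0,A/B)} with A = F_n(k), B = F_{n-1}(k).
-- (x,y) ∈ ℤ² lies in t·T iff x ≥ 0, y ≥ 0 and x·(A/B) + y·(B/A) ≤ t,
-- i.e. (clearing the positive denominator A·B) x·A² + y·B² ≤ t·A·B.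
-- Such points satisfy 0 ≤ x, y ≤ t·A·B (when A,B ≥ 1), so we enumerate that box.
latticeCount : ℕ → ℕ → ℕ → ℕ
latticeCount A B t =
  length (filter (λ p → proj₁ p ℕ.* (A ℕ.* A) ℕ.+ proj₂ p ℕ.* (B ℕ.* B) ≤? t ℕ.* A ℕ.* B)
                 (concatMap (λ x → map (λ y → (x , y)) (upTo (suc M))) (upTo (suc M))))
  where M = t ℕ.* A ℕ.* B

ehrhartI : ℕ → ℕ → ℕ → ℕ
ehrhartI k n t = latticeCount (kFib k n) (kFib k (ℕ.pred n)) t

toℚ : ℕ → ℚ
toℚ m = + m / 1

IsQuasiPeriod : (ℕ → ℕ) → ℕ → Set
IsQuasiPeriod f N =
  Data.Product.Σ (ℕ → ℚ) λ c₀ → Data.Product.Σ (ℕ → ℚ) λ c₁ → Data.Product.Σ (ℕ → ℚ) λ c₂ →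
    ((t : ℕ) → 1 ℕ.≤ t →
        (c₀ (t ℕ.+ N) ≡ c₀ t) × (c₁ (t ℕ.+ N) ≡ c₁ t) × (c₂ (t ℕ.+ N) ≡ c₂ t))
    × ((t : ℕ) → 1 ℕ.≤ t →
        toℚ (f t) ≡ c₂ t * (toℚ t * toℚ t) + c₁ t * toℚ t + c₀ t)

-- Write A = F_n, B = F_{n-1}, C = F_{n+1}.  For even n Cassini's identity gives B·C = A² + 1, and
-- B, C are coprime.  The points of tT are the (x, y) ∈ ℕ² with x·A² + y·B² ≤ t·A·B; counting them
-- column by column, replacing t by t + A adds a strip of B columns.  The strip for t + A has exactly
-- A² more points than the strip for t: its i-th column gains ⌊(v + A²)/B⌋ − ⌊v/B⌋ = C − [B ∣ v],
-- where the values v run through an arithmetic progression of difference C, so exactly one of them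
-- is divisible by B, and B·C − 1 = A².  Thus I(t + 2A) − 2 I(t + A) + I(t) = A² for every t, and a
-- function with constant second difference at step A is a quasi-polynomial of period A.  The
-- triangle for n + 1 is the same configuration with B and C exchanged.

module Submission where

open import Defs
open import Data.Nat as ℕ using (ℕ; zero; suc; NonZero)
import Data.Nat.Properties as ℕ
open import Data.Nat.DivMod using (_/_; _%_; m*n/n≡m; /-mono-≤; m/n*n≤m; m/n≤m; +-distrib-/-∣ʳ; m<n⇒m/n≡0; m/n/o≡m/[n*o]; m≡m%n+[m/n]*n; m%n<n; m<n⇒m%n≡m; [m+n]%n≡m%n)
open import Data.Nat.Divisibility using (_∣_; divides; _∣?_; ∣m+n∣m⇒∣n; n∣m*n; ∣⇒≤; n∣m⇒m%n≡0; ∣n⇒∣m*n; ∣m⇒∣m*n; ∣-trans; ∣1⇒≡1)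
open import Data.Nat.Coprimality as Coprime using (Coprime; coprime-Bézout; coprime-divisor)
open import Data.Nat.GCD using (module Bézout)
import Data.Integer as ℤ
import Data.Integer.Properties as ℤ
import Data.Rational.Unnormalised as ℚᵘ
import Data.Rational.Unnormalised.Properties as ℚᵘ
open import Data.Rational as ℚ using (ℚ)
import Data.Rational.Properties as ℚ
open import Data.Rational.Solver using (module +-*-Solver)
open import Data.List using (List; []; [_]; _++_; upTo; filter; length; concatMap; map)
import Data.List.Properties as List
open import Data.Product using (_×_; _,_; proj₁; proj₂; ∃-syntax)
open import Data.Sum using (inj₁; inj₂)
open import Function using (_∘_)
open import Level using (0ℓ)
open import Relation.Nullary using (Dec; yes; no; ¬_; contradiction)
open import Relation.Unary using (Pred; Decidable)
open import Relation.Binary.PropositionalEquality hiding ([_])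
open import Data.Nat.Tactic.RingSolver using (solve-∀)

module QuasiPolynomial where

  open import Data.Rational using (½; 1ℚ; 0ℚ; _+_; _*_; _-_)

  toℚᵘ-toℚ : ∀ m → ℚ.toℚᵘ (toℚ m) ℚᵘ.≃ ℚᵘ.mkℚᵘ (ℤ.+ m) 0
  toℚᵘ-toℚ m = ℚ.toℚᵘ-fromℚᵘ (ℚᵘ.mkℚᵘ (ℤ.+ m) 0)

  toℚ-+ : ∀ m n → toℚ (m ℕ.+ n) ≡ toℚ m + toℚ n
  toℚ-+ m n = ℚ.toℚᵘ-injective (begin
    ℚ.toℚᵘ (toℚ (m ℕ.+ n))                ≈⟨ toℚᵘ-toℚ (m ℕ.+ n) ⟩
    ℚᵘ.mkℚᵘ (ℤ.+ (m ℕ.+ n)) 0                ≈⟨ ℚᵘ.*≡* numerators ⟩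
    ℚᵘ.mkℚᵘ (ℤ.+ m) 0 ℚᵘ.+ ℚᵘ.mkℚᵘ (ℤ.+ n) 0   ≈⟨ ℚᵘ.+-cong (toℚᵘ-toℚ m) (toℚᵘ-toℚ n) ⟨
    ℚ.toℚᵘ (toℚ m) ℚᵘ.+ ℚ.toℚᵘ (toℚ n)     ≈⟨ ℚ.toℚᵘ-homo-+ (toℚ m) (toℚ n) ⟨
    ℚ.toℚᵘ (toℚ m + toℚ n)                ∎)
    where
    open ℚᵘ.≃-Reasoning
    numerators : ℤ.+ (m ℕ.+ n) ℤ.* ℤ.+ 1 ≡ (ℤ.+ m ℤ.* ℤ.+ 1 ℤ.+ ℤ.+ n ℤ.* ℤ.+ 1) ℤ.* ℤ.+ 1
    numerators rewrite ℤ.*-identityʳ (ℤ.+ m) | ℤ.*-identityʳ (ℤ.+ n) = cong (ℤ._* ℤ.+ 1) (ℤ.pos-+ m n)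

  toℚ-* : ∀ m n → toℚ (m ℕ.* n) ≡ toℚ m * toℚ n
  toℚ-* m n = ℚ.toℚᵘ-injective (begin
    ℚ.toℚᵘ (toℚ (m ℕ.* n))                ≈⟨ toℚᵘ-toℚ (m ℕ.* n) ⟩
    ℚᵘ.mkℚᵘ (ℤ.+ (m ℕ.* n)) 0                ≈⟨ ℚᵘ.*≡* (cong (ℤ._* ℤ.+ 1) (ℤ.pos-* m n)) ⟩
    ℚᵘ.mkℚᵘ (ℤ.+ m) 0 ℚᵘ.* ℚᵘ.mkℚᵘ (ℤ.+ n) 0   ≈⟨ ℚᵘ.*-cong (toℚᵘ-toℚ m) (toℚᵘ-toℚ n) ⟨
    ℚ.toℚᵘ (toℚ m) ℚᵘ.* ℚ.toℚᵘ (toℚ n)     ≈⟨ ℚ.toℚᵘ-homo-* (toℚ m) (toℚ n) ⟨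
    ℚ.toℚᵘ (toℚ m * toℚ n)                ∎)
    where open ℚᵘ.≃-Reasoning

  toℚ-injective : ∀ {m n} → toℚ m ≡ toℚ n → m ≡ n
  toℚ-injective {m} {n} eq with ℚᵘ.≃-trans (ℚᵘ.≃-sym (toℚᵘ-toℚ m)) (ℚᵘ.≃-trans (ℚ.toℚᵘ-cong eq) (toℚᵘ-toℚ n))
  ... | ℚᵘ.*≡* eq′ = ℤ.+-injective (trans (sym (ℤ.*-identityʳ (ℤ.+ m))) (trans eq′ (ℤ.*-identityʳ (ℤ.+ n))))

  toℚ-nonZero : ∀ n .{{_ : NonZero n}} → ℚ.NonZero (toℚ n)
  toℚ-nonZero (suc n) = ℚ.≢-nonZero {toℚ (suc n)} (λ eq → ℕ.1+n≢0 (toℚ-injective {suc n} {0} eq))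

  ½-double : ∀ x → ½ * (x + x) ≡ x
  ½-double x = begin
    ½ * (x + x)     ≡⟨ ℚ.*-distribˡ-+ ½ x x ⟩
    ½ * x + ½ * x   ≡⟨ ℚ.*-distribʳ-+ x ½ ½ ⟨
    1ℚ * x          ≡⟨ ℚ.*-identityˡ x ⟩
    x               ∎
    where open ≡-Reasoning

  module SecondDifference (g : ℕ → ℚ) (c : ℚ)
    (recurrence : ∀ q → g (2 ℕ.+ q) + g q ≡ g (1 ℕ.+ q) + g (1 ℕ.+ q) + c) where

    open +-*-Solver

    -- Doubled so that no ½ occurs and every step is a ring identity.
    twiceClosedForm : ℚ → ℚ
    twiceClosedForm x = (g 0 + g 0) + (x + x) * (g 1 - g 0) + (x * x - x) * c

    g+g≡twiceClosedForm : ∀ q → g q + g q ≡ twiceClosedForm (toℚ q)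
    g+g≡twiceClosedForm zero = solve 3 (λ a d c →
        a :+ a := (a :+ a) :+ (con 0ℚ :+ con 0ℚ) :* d :+ (con 0ℚ :* con 0ℚ :- con 0ℚ) :* c)
      refl (g 0) (g 1 - g 0) c
    g+g≡twiceClosedForm (suc zero) = solve 3 (λ a b c →
        b :+ b := (a :+ a) :+ (con 1ℚ :+ con 1ℚ) :* (b :- a) :+ (con 1ℚ :* con 1ℚ :- con 1ℚ) :* c)
      refl (g 0) (g 1) c
    g+g≡twiceClosedForm (suc (suc q)) = begin
      g (2 ℕ.+ q) + g (2 ℕ.+ q)
        ≡⟨ eliminate (g (2 ℕ.+ q)) (g q) ⟩
      (g (2 ℕ.+ q) + g q) + (g (2 ℕ.+ q) + g q) - (g q + g q)
        ≡⟨ cong₂ (λ u v → u + u - v) (recurrence q) (g+g≡twiceClosedForm q) ⟩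
      (g (1 ℕ.+ q) + g (1 ℕ.+ q) + c) + (g (1 ℕ.+ q) + g (1 ℕ.+ q) + c) - twiceClosedForm x
        ≡⟨ cong (λ u → (u + c) + (u + c) - twiceClosedForm x) (g+g≡twiceClosedForm (suc q)) ⟩
      (twiceClosedForm (toℚ (1 ℕ.+ q)) + c) + (twiceClosedForm (toℚ (1 ℕ.+ q)) + c) - twiceClosedForm x
        ≡⟨ cong (λ u → (twiceClosedForm u + c) + (twiceClosedForm u + c) - twiceClosedForm x) (toℚ-+ 1 q) ⟩
      (twiceClosedForm (1ℚ + x) + c) + (twiceClosedForm (1ℚ + x) + c) - twiceClosedForm x
        ≡⟨ step (g 0) (g 1 - g 0) c x ⟩
      twiceClosedForm (1ℚ + (1ℚ + x))
        ≡⟨ cong twiceClosedForm (trans (toℚ-+ 1 (1 ℕ.+ q)) (cong (λ u → 1ℚ + u) (toℚ-+ 1 q))) ⟨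
      twiceClosedForm (toℚ (2 ℕ.+ q))  ∎
      where
      open ≡-Reasoning
      x = toℚ q
      eliminate : ∀ y z → y + y ≡ (y + z) + (y + z) - (z + z)
      eliminate = solve 2 (λ y z → y :+ y := (y :+ z) :+ (y :+ z) :- (z :+ z)) refl
      step = solve 4 (λ a d c x →
        let D = λ y → (a :+ a) :+ (y :+ y) :* d :+ (y :* y :- y) :* c in
        (D (con 1ℚ :+ x) :+ c) :+ (D (con 1ℚ :+ x) :+ c) :- D x := D (con 1ℚ :+ (con 1ℚ :+ x)))
        refl

  module ConstantSecondDifference (f : ℕ → ℕ) (N c : ℕ) .{{_ : NonZero N}}
    (recurrence : ∀ t → f (t ℕ.+ N ℕ.+ N) ℕ.+ f t ≡ f (t ℕ.+ N) ℕ.+ f (t ℕ.+ N) ℕ.+ c) where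

    open +-*-Solver
    private instance
      N-nonZero : ℚ.NonZero (toℚ N)
      N-nonZero = toℚ-nonZero N

    residue-periodic : ∀ t → (t ℕ.+ N) % N ≡ t % N
    residue-periodic t = [m+n]%n≡m%n t N

    w C : ℚ
    w = ℚ.1/ toℚ N
    C = toℚ c

    class : ℕ → ℕ → ℚ
    class r q = toℚ (f (r ℕ.+ q ℕ.* N))

    class-recurrence : ∀ r q → class r (2 ℕ.+ q) + class r q ≡ class r (1 ℕ.+ q) + class r (1 ℕ.+ q) + C
    class-recurrence r q = begin
      toℚ (f (r ℕ.+ (2 ℕ.+ q) ℕ.* N)) + toℚ (f s)            ≡⟨ toℚ-+ (f (r ℕ.+ (2 ℕ.+ q) ℕ.* N)) (f s) ⟨
      toℚ (f (r ℕ.+ (2 ℕ.+ q) ℕ.* N) ℕ.+ f s)               ≡⟨ cong (λ u → toℚ (f u ℕ.+ f s)) (shift₂ r q N) ⟩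
      toℚ (f (s ℕ.+ N ℕ.+ N) ℕ.+ f s)                        ≡⟨ cong toℚ (recurrence s) ⟩
      toℚ (f (s ℕ.+ N) ℕ.+ f (s ℕ.+ N) ℕ.+ c)                ≡⟨ cong (λ u → toℚ (f u ℕ.+ f u ℕ.+ c)) (shift₁ r q N) ⟨
      toℚ (f s′ ℕ.+ f s′ ℕ.+ c)                              ≡⟨ toℚ-+ (f s′ ℕ.+ f s′) c ⟩
      toℚ (f s′ ℕ.+ f s′) + C                                ≡⟨ cong (_+ C) (toℚ-+ (f s′) (f s′)) ⟩
      toℚ (f s′) + toℚ (f s′) + C                            ∎
      where
      open ≡-Reasoning
      s = r ℕ.+ q ℕ.* N
      s′ = r ℕ.+ (1 ℕ.+ q) ℕ.* N
      shift₁ : ∀ r q N → r ℕ.+ (1 ℕ.+ q) ℕ.* N ≡ r ℕ.+ q ℕ.* N ℕ.+ N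
      shift₁ = solve-∀
      shift₂ : ∀ r q N → r ℕ.+ (2 ℕ.+ q) ℕ.* N ≡ r ℕ.+ q ℕ.* N ℕ.+ N ℕ.+ N
      shift₂ = solve-∀

    quadratic : ℚ
    quadratic = ½ * C * w * w

    -- Coefficients of ½ · twiceClosedForm ((T − r)/N) as a polynomial in T, where t = r + q·N.
    linear constant : ℕ → ℚ
    linear r = ½ * ((w + w) * (class r 1 - class r 0) - C * ((toℚ r + toℚ r) * w * w + w))
    constant r = ½ * ((class r 0 + class r 0) - (toℚ r + toℚ r) * w * (class r 1 - class r 0)
                      + C * (toℚ r * toℚ r * w * w + toℚ r * w))

    value : ∀ t → toℚ (f t) ≡ quadratic * (toℚ t * toℚ t) + linear (t % N) * toℚ t + constant (t % N)
    value t = begin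
      toℚ (f t)                                         ≡⟨ cong (toℚ ∘ f) t≡r+qN ⟩
      class r q                                         ≡⟨ ½-double (class r q) ⟨
      ½ * (class r q + class r q)                       ≡⟨ cong (½ *_) (g+g≡twiceClosedForm q) ⟩
      ½ * twiceClosedForm x                             ≡⟨ cong (λ y → ½ * twiceClosedForm y) x≡[T-ρ]w ⟩
      ½ * twiceClosedForm ((T - ρ) * w)                 ≡⟨ expand ½ (class r 0) (class r 1 - class r 0) C w T ρ ⟩
      quadratic * (T * T) + linear r * T + constant r   ∎
      where
      open ≡-Reasoning
      open SecondDifference (class (t % N)) C (class-recurrence (t % N))
      r = t % N
      q = t / N
      ρ = toℚ r
      x = toℚ q
      T = toℚ t
      t≡r+qN : t ≡ r ℕ.+ q ℕ.* N
      t≡r+qN = m≡m%n+[m/n]*n t N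
      x≡[T-ρ]w : x ≡ (T - ρ) * w
      x≡[T-ρ]w = sym (begin
        (T - ρ) * w                      ≡⟨ cong (λ u → (u - ρ) * w) (trans (cong toℚ t≡r+qN) (trans (toℚ-+ r (q ℕ.* N)) (cong (ρ +_) (toℚ-* q N)))) ⟩
        ((ρ + x * toℚ N) - ρ) * w        ≡⟨ solve 4 (λ ρ x n w → ((ρ :+ x :* n) :- ρ) :* w := x :* (n :* w)) refl ρ x (toℚ N) w ⟩
        x * (toℚ N * w)                  ≡⟨ cong (x *_) (ℚ.*-inverseʳ (toℚ N)) ⟩
        x * 1ℚ                           ≡⟨ ℚ.*-identityʳ x ⟩
        x                                ∎)
      expand : ∀ h a d C w T ρ → h * ((a + a) + (((T - ρ) * w) + ((T - ρ) * w)) * d + (((T - ρ) * w) * ((T - ρ) * w) - (T - ρ) * w) * C)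
                                ≡ h * C * w * w * (T * T) + h * ((w + w) * d - C * ((ρ + ρ) * w * w + w)) * T
                                  + h * ((a + a) - (ρ + ρ) * w * d + C * (ρ * ρ * w * w + ρ * w))
      expand = solve 7 (λ h a d C w T ρ →
        let x = (T :- ρ) :* w in
        h :* ((a :+ a) :+ (x :+ x) :* d :+ (x :* x :- x) :* C)
          := h :* C :* w :* w :* (T :* T) :+ h :* ((w :+ w) :* d :- C :* ((ρ :+ ρ) :* w :* w :+ w)) :* T
             :+ h :* ((a :+ a) :- (ρ :+ ρ) :* w :* d :+ C :* (ρ :* ρ :* w :* w :+ ρ :* w))) refl

  secondDifference⇒quasiPeriod : (f : ℕ → ℕ) (N c : ℕ) .{{_ : NonZero N}} →
    (∀ t → f (t ℕ.+ N ℕ.+ N) ℕ.+ f t ≡ f (t ℕ.+ N) ℕ.+ f (t ℕ.+ N) ℕ.+ c) →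
    IsQuasiPeriod f N
  secondDifference⇒quasiPeriod f N c recurrence =
    (λ t → constant (t % N)) , (λ t → linear (t % N)) , (λ _ → quadratic) ,
    (λ t _ → cong constant (residue-periodic t) , cong linear (residue-periodic t) , refl) ,
    (λ t _ → value t)
    where open ConstantSecondDifference f N c recurrence

  IsQuasiPeriod-cong : ∀ {f g : ℕ → ℕ} {N} → (∀ t → f t ≡ g t) → IsQuasiPeriod g N → IsQuasiPeriod f N
  IsQuasiPeriod-cong f≗g (c₀ , c₁ , c₂ , periodic , value) =
    c₀ , c₁ , c₂ , periodic , λ t 1≤t → trans (cong toℚ (f≗g t)) (value t 1≤t)

open QuasiPolynomial using (IsQuasiPeriod-cong; secondDifference⇒quasiPeriod)
open import Data.Nat using (_+_; _*_; _∸_; _≤_; _<_; _≤?_; _⊓_; s≤s; z≤n)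

∑< : ℕ → (ℕ → ℕ) → ℕ
∑< zero    f = 0
∑< (suc n) f = ∑< n f + f n

syntax ∑< n (λ i → e) = ∑[ i < n ] e

∑-cong : ∀ n {f g : ℕ → ℕ} → (∀ i → i < n → f i ≡ g i) → ∑< n f ≡ ∑< n g
∑-cong zero    eq = refl
∑-cong (suc n) eq = cong₂ _+_ (∑-cong n (λ i i<n → eq i (ℕ.m<n⇒m<1+n i<n))) (eq n ℕ.≤-refl)

∑-zero : ∀ n {f : ℕ → ℕ} → (∀ i → i < n → f i ≡ 0) → ∑< n f ≡ 0
∑-zero zero    eq = refl
∑-zero (suc n) eq = cong₂ _+_ (∑-zero n (λ i i<n → eq i (ℕ.m<n⇒m<1+n i<n))) (eq n ℕ.≤-refl)

∑-const : ∀ n c → ∑[ i < n ] c ≡ n * c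
∑-const zero    c = refl
∑-const (suc n) c = trans (cong (_+ c) (∑-const n c)) (ℕ.+-comm (n * c) c)

∑-+ : ∀ n (f g : ℕ → ℕ) → ∑[ i < n ] (f i + g i) ≡ ∑< n f + ∑< n g
∑-+ zero    f g = refl
∑-+ (suc n) f g = trans (cong (_+ (f n + g n)) (∑-+ n f g)) (swap-middle (∑< n f) (∑< n g) (f n) (g n))
  where
  swap-middle : ∀ a b c d → (a + b) + (c + d) ≡ (a + c) + (b + d)
  swap-middle = solve-∀

∑-split : ∀ m n (f : ℕ → ℕ) → ∑< (m + n) f ≡ ∑< m f + ∑[ i < n ] f (m + i)
∑-split m zero    f = trans (cong (λ k → ∑< k f) (ℕ.+-identityʳ m)) (sym (ℕ.+-identityʳ _))
∑-split m (suc n) f = begin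
  ∑< (m + suc n) f                                  ≡⟨ cong (λ k → ∑< k f) (ℕ.+-suc m n) ⟩
  ∑< (m + n) f + f (m + n)                          ≡⟨ cong (_+ f (m + n)) (∑-split m n f) ⟩
  ∑< m f + ∑[ i < n ] f (m + i) + f (m + n)         ≡⟨ ℕ.+-assoc (∑< m f) _ _ ⟩
  ∑< m f + ∑[ i < suc n ] f (m + i)                 ∎
  where open ≡-Reasoning

∑-head : ∀ n (f : ℕ → ℕ) → ∑< (suc n) f ≡ f 0 + ∑[ i < n ] f (suc i)
∑-head zero    f = ℕ.+-comm 0 (f 0)
∑-head (suc n) f = trans (cong (_+ f (suc n)) (∑-head n f)) (ℕ.+-assoc (f 0) _ _)

∑-reverse : ∀ n (f : ℕ → ℕ) → ∑< n f ≡ ∑[ i < n ] f (n ∸ suc i)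
∑-reverse zero    f = refl
∑-reverse (suc n) f = begin
  ∑< n f + f n                               ≡⟨ cong (_+ f n) (∑-reverse n f) ⟩
  ∑[ i < n ] f (n ∸ suc i) + f n             ≡⟨ ℕ.+-comm _ (f n) ⟩
  f n + ∑[ i < n ] f (n ∸ suc i)             ≡⟨ ∑-head n (λ i → f (n ∸ i)) ⟨
  ∑[ i < suc n ] f (n ∸ i)                   ∎
  where open ≡-Reasoning

∑-swap : ∀ m n (f : ℕ → ℕ → ℕ) → ∑[ x < m ] ∑< n (f x) ≡ ∑[ y < n ] ∑[ x < m ] f x y
∑-swap zero    n f = sym (∑-zero n (λ _ _ → refl))
∑-swap (suc m) n f = trans (cong (_+ ∑< n (f m)) (∑-swap m n f))
                           (sym (∑-+ n (λ y → ∑[ x < m ] f x y) (f m)))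

∑-extend : ∀ m n (f : ℕ → ℕ) → (∀ i → m ≤ i → f i ≡ 0) → m ≤ n → ∑< n f ≡ ∑< m f
∑-extend m n f vanish m≤n with ℕ.m≤n⇒m<n∨m≡n m≤n
... | inj₂ refl = refl
∑-extend m (suc n) f vanish _ | inj₁ (s≤s m≤n) =
  trans (cong₂ _+_ (∑-extend m n f vanish m≤n) (vanish n m≤n)) (ℕ.+-identityʳ _)

∑-single : ∀ n j (f : ℕ → ℕ) → j < n → (∀ i → i < n → i ≢ j → f i ≡ 0) → f j ≡ 1 → ∑< n f ≡ 1
∑-single (suc n) j f (s≤s j≤n) vanish fj≡1 with ℕ.m≤n⇒m<n∨m≡n j≤n
... | inj₂ refl = cong₂ _+_ (∑-zero n (λ i i<n → vanish i (ℕ.m<n⇒m<1+n i<n) (ℕ.<⇒≢ i<n))) fj≡1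
... | inj₁ j<n = cong₂ _+_ (∑-single n j f j<n (λ i i<n → vanish i (ℕ.m<n⇒m<1+n i<n)) fj≡1)
                           (vanish n ℕ.≤-refl (ℕ.>⇒≢ j<n))

𝟙 : {P : Set} → Dec P → ℕ
𝟙 (yes _) = 1
𝟙 (no _)  = 0

𝟙-yes : {P : Set} (p? : Dec P) → P → 𝟙 p? ≡ 1
𝟙-yes (yes _) _ = refl
𝟙-yes (no ¬p) p = contradiction p ¬p

𝟙-no : {P : Set} (p? : Dec P) → ¬ P → 𝟙 p? ≡ 0
𝟙-no (yes p) ¬p = contradiction p ¬p
𝟙-no (no _)  _  = refl

𝟙-cong : {P Q : Set} (p? : Dec P) (q? : Dec Q) → (P → Q) → (Q → P) → 𝟙 p? ≡ 𝟙 q?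
𝟙-cong (yes _) (yes _) _   _   = refl
𝟙-cong (no _)  (no _)  _   _   = refl
𝟙-cong (yes p) (no ¬q) p⇒q _   = contradiction (p⇒q p) ¬q
𝟙-cong (no ¬p) (yes q) _   q⇒p = contradiction (q⇒p q) ¬p

∑-𝟙-≤ : ∀ n m → ∑[ y < n ] 𝟙 (y ≤? m) ≡ n ⊓ suc m
∑-𝟙-≤ zero    m = refl
∑-𝟙-≤ (suc n) m with n ≤? m
... | yes n≤m = trans (cong (_+ 1) (trans (∑-𝟙-≤ n m) (ℕ.m≤n⇒m⊓n≡m (ℕ.m≤n⇒m≤1+n n≤m))))
                      (trans (ℕ.+-comm n 1) (sym (ℕ.m≤n⇒m⊓n≡m (s≤s n≤m))))
... | no n≰m  = trans (cong (_+ 0) (trans (∑-𝟙-≤ n m) (ℕ.m≥n⇒m⊓n≡n (ℕ.≰⇒> n≰m))))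
                      (trans (ℕ.+-identityʳ _) (sym (ℕ.m≥n⇒m⊓n≡n (ℕ.m≤n⇒m≤1+n (ℕ.≰⇒> n≰m)))))

module _ {A : Set} {P : Pred A 0ℓ} (P? : Decidable P) where

  length-filter-[_] : ∀ x → length (filter P? [ x ]) ≡ 𝟙 (P? x)
  length-filter-[ x ] with P? x
  ... | yes _ = refl
  ... | no _  = refl

  length-filter-concatMap-upTo : ∀ (g : ℕ → List A) n →
    length (filter P? (concatMap g (upTo n))) ≡ ∑[ x < n ] length (filter P? (g x))
  length-filter-concatMap-upTo g zero    = refl
  length-filter-concatMap-upTo g (suc n) = begin
    length (filter P? (concatMap g (upTo (suc n))))
      ≡⟨ cong (length ∘ filter P? ∘ concatMap g) (List.upTo-∷ʳ n) ⟨
    length (filter P? (concatMap g (upTo n ++ [ n ])))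
      ≡⟨ cong (length ∘ filter P?) (List.concatMap-++ g (upTo n) [ n ]) ⟩
    length (filter P? (concatMap g (upTo n) ++ (g n ++ [])))
      ≡⟨ cong length (List.filter-++ P? (concatMap g (upTo n)) (g n ++ [])) ⟩
    length (filter P? (concatMap g (upTo n)) ++ filter P? (g n ++ []))
      ≡⟨ List.length-++ (filter P? (concatMap g (upTo n))) ⟩
    length (filter P? (concatMap g (upTo n))) + length (filter P? (g n ++ []))
      ≡⟨ cong₂ _+_ (length-filter-concatMap-upTo g n) (cong (length ∘ filter P?) (List.++-identityʳ (g n))) ⟩
    ∑[ x < suc n ] length (filter P? (g x))  ∎
    where open ≡-Reasoning

  length-filter-map-upTo : ∀ (h : ℕ → A) n → length (filter P? (map h (upTo n))) ≡ ∑[ y < n ] 𝟙 (P? (h y))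
  length-filter-map-upTo h n = begin
    length (filter P? (map h (upTo n)))                 ≡⟨ cong (length ∘ filter P?) (List.concatMap-pure (map h (upTo n))) ⟨
    length (filter P? (concatMap [_] (map h (upTo n)))) ≡⟨ cong (length ∘ filter P?) (List.concatMap-map [_] h (upTo n)) ⟩
    length (filter P? (concatMap ([_] ∘ h) (upTo n)))   ≡⟨ length-filter-concatMap-upTo ([_] ∘ h) n ⟩
    ∑[ y < n ] length (filter P? [ h y ])               ≡⟨ ∑-cong n (λ y _ → length-filter-[ h y ]) ⟩
    ∑[ y < n ] 𝟙 (P? (h y))                             ∎
    where open ≡-Reasoning

boxCount : ℕ → ℕ → ℕ → ℕ → ℕ
boxCount a b s n = ∑[ x < n ] ∑[ y < n ] 𝟙 (x * a + y * b ≤? s)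

latticeCount≡boxCount : ∀ A B t → latticeCount A B t ≡ boxCount (A * A) (B * B) (t * A * B) (suc (t * A * B))
latticeCount≡boxCount A B t =
  trans (length-filter-concatMap-upTo P? (λ x → map (x ,_) (upTo n)) n)
        (∑-cong n (λ x _ → length-filter-map-upTo P? (x ,_) n))
  where
  n = suc (t * A * B)
  P? = λ (p : ℕ × ℕ) → proj₁ p * (A * A) + proj₂ p * (B * B) ≤? t * A * B

boxCount-comm : ∀ a b s n → boxCount a b s n ≡ boxCount b a s n
boxCount-comm a b s n = trans (∑-swap n n (λ x y → 𝟙 (x * a + y * b ≤? s)))
  (∑-cong n (λ y _ → ∑-cong n (λ x _ →
    𝟙-cong (x * a + y * b ≤? s) (y * b + x * a ≤? s)
           (subst (_≤ s) (ℕ.+-comm (x * a) (y * b))) (subst (_≤ s) (ℕ.+-comm (y * b) (x * a))))))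

columnCount : (b : ℕ) .{{_ : NonZero b}} → ℕ → ℕ → ℕ
columnCount b s a with a ≤? s
... | yes _ = suc ((s ∸ a) / b)
... | no _  = 0

module _ (b : ℕ) .{{_ : NonZero b}} where

  columnCount-≤ : ∀ s a → a ≤ s → columnCount b s a ≡ suc ((s ∸ a) / b)
  columnCount-≤ s a a≤s with a ≤? s
  ... | yes _   = refl
  ... | no a≰s  = contradiction a≤s a≰s

  columnCount-> : ∀ s a → ¬ a ≤ s → columnCount b s a ≡ 0
  columnCount-> s a a≰s with a ≤? s
  ... | yes a≤s = contradiction a≤s a≰s
  ... | no _    = refl

  columnCount-+ : ∀ s a d → columnCount b (s + d) (d + a) ≡ columnCount b s a
  columnCount-+ s a d with a ≤? s
  ... | yes a≤s = begin
    columnCount b (s + d) (d + a)  ≡⟨ columnCount-≤ (s + d) (d + a) (subst (d + a ≤_) (ℕ.+-comm d s) (ℕ.+-monoʳ-≤ d a≤s)) ⟩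
    suc ((s + d ∸ (d + a)) / b)    ≡⟨ cong (λ u → suc ((u ∸ (d + a)) / b)) (ℕ.+-comm s d) ⟩
    suc ((d + s ∸ (d + a)) / b)    ≡⟨ cong (λ u → suc (u / b)) (ℕ.[m+n]∸[m+o]≡n∸o d s a) ⟩
    suc ((s ∸ a) / b)              ∎
    where open ≡-Reasoning
  ... | no a≰s  = columnCount-> (s + d) (d + a) (a≰s ∘ ℕ.+-cancelˡ-≤ d a s ∘ subst (d + a ≤_) (ℕ.+-comm s d))

  ∑-column : ∀ a s n → s < n → ∑[ y < n ] 𝟙 (a + y * b ≤? s) ≡ columnCount b s a
  ∑-column a s n s<n with a ≤? s
  ... | no a≰s  = ∑-zero n (λ y _ → 𝟙-no (a + y * b ≤? s) (a≰s ∘ ℕ.m+n≤o⇒m≤o a))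
  ... | yes a≤s = begin
    ∑[ y < n ] 𝟙 (a + y * b ≤? s)  ≡⟨ ∑-cong n (λ y _ → 𝟙-cong (a + y * b ≤? s) (y ≤? m) (below y) (above y)) ⟩
    ∑[ y < n ] 𝟙 (y ≤? m)          ≡⟨ ∑-𝟙-≤ n m ⟩
    n ⊓ suc m                      ≡⟨ ℕ.m≥n⇒m⊓n≡n m<n ⟩
    suc m                          ∎
    where
    open ≡-Reasoning
    m = (s ∸ a) / b
    m<n : suc m ≤ n
    m<n = ℕ.≤-trans (s≤s (ℕ.≤-trans (m/n≤m (s ∸ a) b) (ℕ.m∸n≤m s a))) s<n
    below : ∀ y → a + y * b ≤ s → y ≤ m
    below y le = subst (_≤ m) (m*n/n≡m y b) (/-mono-≤ {m = y * b} {n = s ∸ a} yb≤s∸a (ℕ.≤-refl {b}))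
      where
      yb≤s∸a : y * b ≤ s ∸ a
      yb≤s∸a = ℕ.+-cancelˡ-≤ a (y * b) (s ∸ a) (subst (a + y * b ≤_) (sym (ℕ.m+[n∸m]≡n a≤s)) le)
    above : ∀ y → y ≤ m → a + y * b ≤ s
    above y y≤m = subst (a + y * b ≤_) (ℕ.m+[n∸m]≡n a≤s)
                        (ℕ.+-monoʳ-≤ a (ℕ.≤-trans (ℕ.*-monoˡ-≤ b y≤m) (m/n*n≤m (s ∸ a) b)))

triangleCount : (a b : ℕ) .{{_ : NonZero b}} → ℕ → ℕ
triangleCount a b s = ∑[ x < suc s ] columnCount b s (x * a)

-- The points in the columns x < m under the line x·a + y·b = s + m·a, column m − 1 − i first.
stripCount : (a b : ℕ) .{{_ : NonZero b}} → ℕ → ℕ → ℕ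
stripCount a b m s = ∑[ i < m ] suc ((s + suc i * a) / b)

module _ (a b : ℕ) .{{_ : NonZero a}} .{{_ : NonZero b}} where

  ∑-columnCount : ∀ s n → s < n → ∑[ x < n ] columnCount b s (x * a) ≡ triangleCount a b s
  ∑-columnCount s n s<n = ∑-extend (suc s) n _ empty s<n
    where
    empty : ∀ x → suc s ≤ x → columnCount b s (x * a) ≡ 0
    empty x s<x = columnCount-> b s (x * a) (ℕ.<⇒≱ (ℕ.<-≤-trans s<x (ℕ.m≤m*n x a)))

  boxCount≡triangleCount : ∀ s n → s < n → boxCount a b s n ≡ triangleCount a b s
  boxCount≡triangleCount s n s<n =
    trans (∑-cong n (λ x _ → ∑-column b (x * a) s n s<n)) (∑-columnCount s n s<n)

  triangleCount-+ : ∀ m s → triangleCount a b (s + m * a) ≡ stripCount a b m s + triangleCount a b s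
  triangleCount-+ m s = begin
    triangleCount a b (s + m * a)                                ≡⟨ ∑-columnCount (s + m * a) (m + n) (ℕ.m≤n+m n m) ⟨
    ∑[ x < m + n ] columnCount b (s + m * a) (x * a)              ≡⟨ ∑-split m n _ ⟩
    ∑[ x < m ] columnCount b (s + m * a) (x * a)
      + ∑[ x < n ] columnCount b (s + m * a) ((m + x) * a)       ≡⟨ cong₂ _+_ strip (∑-cong n (λ x _ → shift x)) ⟩
    stripCount a b m s + ∑[ x < n ] columnCount b s (x * a)      ≡⟨ cong (stripCount a b m s +_) (∑-columnCount s n (s≤s (ℕ.m≤m+n s _))) ⟩
    stripCount a b m s + triangleCount a b s                     ∎
    where
    open ≡-Reasoning
    n = suc (s + m * a)
    shift : ∀ x → columnCount b (s + m * a) ((m + x) * a) ≡ columnCount b s (x * a)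
    shift x = trans (cong (columnCount b (s + m * a)) (ℕ.*-distribʳ-+ a m x)) (columnCount-+ b s (x * a) (m * a))
    strip : ∑[ x < m ] columnCount b (s + m * a) (x * a) ≡ stripCount a b m s
    strip = trans (∑-reverse m _) (∑-cong m column)
      where
      column : ∀ i → i < m → columnCount b (s + m * a) ((m ∸ suc i) * a) ≡ suc ((s + suc i * a) / b)
      column i i<m = begin
        columnCount b (s + m * a) (x * a)                    ≡⟨ cong₂ (columnCount b) s+ma≡ (sym (ℕ.+-identityʳ (x * a))) ⟩
        columnCount b (s + suc i * a + x * a) (x * a + 0)   ≡⟨ columnCount-+ b (s + suc i * a) 0 (x * a) ⟩
        columnCount b (s + suc i * a) 0                      ≡⟨ columnCount-≤ b (s + suc i * a) 0 z≤n ⟩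
        suc ((s + suc i * a) / b)                            ∎
        where
        x = m ∸ suc i
        s+ma≡ : s + m * a ≡ s + suc i * a + x * a
        s+ma≡ = begin
          s + m * a                  ≡⟨ cong (λ k → s + k * a) (trans (ℕ.+-comm (suc i) x) (ℕ.m∸n+n≡m i<m)) ⟨
          s + (suc i + x) * a        ≡⟨ cong (s +_) (ℕ.*-distribʳ-+ a (suc i) x) ⟩
          s + (suc i * a + x * a)    ≡⟨ ℕ.+-assoc s _ _ ⟨
          s + suc i * a + x * a      ∎

private instance
  *-nonZero : ∀ {m n} .{{_ : NonZero m}} .{{_ : NonZero n}} → NonZero (m * n)
  *-nonZero {m} {n} = ℕ.m*n≢0 m n

[r+q*n]/n≡q : ∀ {n} .{{_ : NonZero n}} r q → r < n → (r + q * n) / n ≡ q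
[r+q*n]/n≡q {n} r q r<n = begin
  (r + q * n) / n        ≡⟨ +-distrib-/-∣ʳ r (n∣m*n q) ⟩
  r / n + q * n / n      ≡⟨ cong₂ _+_ (m<n⇒m/n≡0 r<n) (m*n/n≡m q n) ⟩
  q                      ∎
  where open ≡-Reasoning

[n*w+r]/[n*n]≡w/n : ∀ {n} .{{_ : NonZero n}} w r → r < n → (n * w + r) / (n * n) ≡ w / n
[n*w+r]/[n*n]≡w/n {n} w r r<n = begin
  (n * w + r) / (n * n)    ≡⟨ m/n/o≡m/[n*o] (n * w + r) n n ⟨
  (n * w + r) / n / n      ≡⟨ cong (λ u → u / n / n) (trans (ℕ.+-comm (n * w) r) (cong (r +_) (ℕ.*-comm n w))) ⟩
  (r + w * n) / n / n      ≡⟨ cong (_/ n) ([r+q*n]/n≡q r w r<n) ⟩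
  w / n                    ∎
  where open ≡-Reasoning

[v+a]/n+[n∣v]≡v/n+c : ∀ n c a v .{{_ : NonZero n}} .{{_ : NonZero c}} → a + 1 ≡ n * c →
  (v + a) / n + 𝟙 (n ∣? v) ≡ v / n + c
[v+a]/n+[n∣v]≡v/n+c n@(suc n-1) c@(suc c-1) a v a+1≡nc =
  split (v % n) (v / n) (m≡m%n+[m/n]*n v n) (m%n<n v n)
  where
  a≡ : a ≡ n-1 + c-1 * n
  a≡ = ℕ.suc-injective (trans (ℕ.+-comm 1 a) (trans a+1≡nc (expand n-1 c-1)))
    where
    expand : ∀ n-1 c-1 → suc n-1 * suc c-1 ≡ suc (n-1 + c-1 * suc n-1)
    expand = solve-∀
  v/n≡ : ∀ r q → v ≡ r + q * n → r < n → v / n ≡ q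
  v/n≡ r q v≡ r<n = trans (cong (_/ n) v≡) ([r+q*n]/n≡q r q r<n)
  split : ∀ r q → v ≡ r + q * n → r < n → (v + a) / n + 𝟙 (n ∣? v) ≡ v / n + c
  split zero q v≡ r<n = begin
    (v + a) / n + 𝟙 (n ∣? v)          ≡⟨ cong₂ _+_ (cong (_/ n) v+a≡) (𝟙-yes (n ∣? v) (divides q v≡)) ⟩
    (n-1 + (q + c-1) * n) / n + 1     ≡⟨ cong (_+ 1) ([r+q*n]/n≡q n-1 (q + c-1) ℕ.≤-refl) ⟩
    q + c-1 + 1                       ≡⟨ trans (ℕ.+-assoc q c-1 1) (cong (q +_) (ℕ.+-comm c-1 1)) ⟩
    q + c                             ≡⟨ cong (_+ c) (v/n≡ 0 q v≡ r<n) ⟨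
    v / n + c                         ∎
    where
    open ≡-Reasoning
    rearrange : ∀ q n-1 c-1 → q * suc n-1 + (n-1 + c-1 * suc n-1) ≡ n-1 + (q + c-1) * suc n-1
    rearrange = solve-∀
    v+a≡ : v + a ≡ n-1 + (q + c-1) * n
    v+a≡ = trans (cong₂ _+_ v≡ a≡) (rearrange q n-1 c-1)
  split (suc r) q v≡ r<n = begin
    (v + a) / n + 𝟙 (n ∣? v)          ≡⟨ cong₂ _+_ (cong (_/ n) v+a≡) (𝟙-no (n ∣? v) n∤v) ⟩
    (r + (q + c) * n) / n + 0         ≡⟨ trans (ℕ.+-identityʳ _) ([r+q*n]/n≡q r (q + c) (ℕ.<-trans (ℕ.n<1+n r) r<n)) ⟩
    q + c                             ≡⟨ cong (_+ c) (v/n≡ (suc r) q v≡ r<n) ⟨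
    v / n + c                         ∎
    where
    open ≡-Reasoning
    rearrange : ∀ r q n-1 c-1 → suc r + q * suc n-1 + (n-1 + c-1 * suc n-1) ≡ r + (q + suc c-1) * suc n-1
    rearrange = solve-∀
    v+a≡ : v + a ≡ r + (q + c) * n
    v+a≡ = trans (cong₂ _+_ v≡ a≡) (rearrange r q n-1 c-1)
    n∤v : ¬ n ∣ v
    n∤v n∣v = ℕ.<⇒≱ r<n (∣⇒≤ (∣m+n∣m⇒∣n (subst (n ∣_) (trans v≡ (ℕ.+-comm (suc r) (q * n))) n∣v) (n∣m*n q)))

∃-multiple : ∀ n {c} .{{_ : NonZero n}} → Coprime n c → ∀ a → ∃[ w ] n ∣ a + c * w
∃-multiple n@(suc n-1) {c} n⊥c a with coprime-Bézout n⊥c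
... | Bézout.+- x y 1+yc≡xn = y * a , divides (a * x) (begin
  a + c * (y * a)     ≡⟨ factor a c y ⟩
  a * (1 + y * c)     ≡⟨ cong (a *_) 1+yc≡xn ⟩
  a * (x * n)         ≡⟨ ℕ.*-assoc a x n ⟨
  a * x * n           ∎)
  where
  open ≡-Reasoning
  factor : ∀ a c y → a + c * (y * a) ≡ a * (1 + y * c)
  factor = solve-∀
... | Bézout.-+ x y 1+xn≡yc = y * n-1 * a , divides (a + x * n-1 * a) (begin
  a + c * (y * n-1 * a)        ≡⟨ regroup a c y n-1 ⟩
  a + (y * c) * n-1 * a        ≡⟨ cong (λ u → a + u * n-1 * a) 1+xn≡yc ⟨
  a + (1 + x * n) * n-1 * a    ≡⟨ factor a x n-1 ⟩
  (a + x * n-1 * a) * n        ∎)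
  where
  open ≡-Reasoning
  regroup : ∀ a c y m → a + c * (y * m * a) ≡ a + (y * c) * m * a
  regroup = solve-∀
  factor : ∀ a x m → a + (1 + x * suc m) * m * a ≡ (a + x * m * a) * suc m
  factor = solve-∀

module _ {n c : ℕ} .{{_ : NonZero n}} (n⊥c : Coprime n c) where

  ∃-solution : ∀ a → ∃[ i ] i < n × n ∣ a + c * i
  ∃-solution a = w % n , m%n<n w n , ∣m+n∣m⇒∣n (subst (n ∣_) split n∣a+cw) (n∣m*n (c * (w / n)))
    where
    w = proj₁ (∃-multiple n n⊥c a)
    n∣a+cw = proj₂ (∃-multiple n n⊥c a)
    regroup : ∀ a c r q n → a + c * (r + q * n) ≡ c * q * n + (a + c * r)
    regroup = solve-∀
    split : a + c * w ≡ c * (w / n) * n + (a + c * (w % n))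
    split = trans (cong (λ u → a + c * u) (m≡m%n+[m/n]*n w n)) (regroup a c (w % n) (w / n) n)

  private
    solution-unique-≤ : ∀ a {i j} → j < n → i ≤ j → n ∣ a + c * i → n ∣ a + c * j → i ≡ j
    solution-unique-≤ a {i} {j} j<n i≤j n∣a+ci n∣a+cj = begin
      i            ≡⟨ ℕ.+-identityʳ i ⟨
      i + 0        ≡⟨ cong (i +_) d≡0 ⟨
      i + d        ≡⟨ ℕ.m+[n∸m]≡n i≤j ⟩
      j            ∎
      where
      open ≡-Reasoning
      d = j ∸ i
      regroup : ∀ a c i d → a + c * (i + d) ≡ (a + c * i) + c * d
      regroup = solve-∀
      n∣cd : n ∣ c * d
      n∣cd = ∣m+n∣m⇒∣n (subst (n ∣_) (trans (cong (λ u → a + c * u) (sym (ℕ.m+[n∸m]≡n i≤j))) (regroup a c i d)) n∣a+cj)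
                       n∣a+ci
      d≡0 : d ≡ 0
      d≡0 = trans (sym (m<n⇒m%n≡m (ℕ.≤-<-trans (ℕ.m∸n≤m j i) j<n))) (n∣m⇒m%n≡0 d n (coprime-divisor n⊥c n∣cd))

  solution-unique : ∀ a {i j} → i < n → j < n → n ∣ a + c * i → n ∣ a + c * j → i ≡ j
  solution-unique a {i} {j} i<n j<n n∣i n∣j with ℕ.≤-total i j
  ... | inj₁ i≤j = solution-unique-≤ a j<n i≤j n∣i n∣j
  ... | inj₂ j≤i = sym (solution-unique-≤ a i<n j≤i n∣j n∣i)

  ∑-𝟙-∣-linear : ∀ a → ∑[ i < n ] 𝟙 (n ∣? a + c * i) ≡ 1
  ∑-𝟙-∣-linear a = ∑-single n i₀ (λ i → 𝟙 (n ∣? a + c * i)) i₀<n others (𝟙-yes (n ∣? a + c * i₀) n∣i₀)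
    where
    i₀ = proj₁ (∃-solution a)
    i₀<n : i₀ < n
    i₀<n = proj₁ (proj₂ (∃-solution a))
    n∣i₀ : n ∣ a + c * i₀
    n∣i₀ = proj₂ (proj₂ (∃-solution a))
    others : ∀ i → i < n → i ≢ i₀ → 𝟙 (n ∣? a + c * i) ≡ 0
    others i i<n i≢i₀ = 𝟙-no (n ∣? a + c * i) (λ n∣i → i≢i₀ (solution-unique a i<n i₀<n n∣i n∣i₀))

module CassiniTriangle (A-1 B-1 C-1 : ℕ)
  (cassini : suc B-1 * suc C-1 ≡ suc A-1 * suc A-1 + 1) (B⊥C : Coprime (suc B-1) (suc C-1)) where

  A B C A² B² : ℕ
  A = suc A-1
  B = suc B-1
  C = suc C-1
  A² = A * A
  B² = B * B

  corner : ℕ → ℕ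
  corner t = t * A * B

  corner-+A : ∀ t → corner (t + A) ≡ corner t + B * A²
  corner-+A t = expand t A B
    where
    expand : ∀ t a b → (t + a) * a * b ≡ t * a * b + b * (a * a)
    expand = solve-∀

  progression : ℕ → ℕ → ℕ
  progression t i = t * A + C-1 + C * i

  corner+[1+i]A²≡ : ∀ t i → i < B → corner t + suc i * A² ≡ B * progression t i + (B ∸ suc i)
  corner+[1+i]A²≡ t i i<B = ℕ.+-cancelʳ-≡ (suc i) _ _ (sym (begin
    B * v + (B ∸ suc i) + suc i        ≡⟨ trans (ℕ.+-assoc (B * v) _ (suc i)) (cong (B * v +_) (ℕ.m∸n+n≡m i<B)) ⟩
    B * v + B                          ≡⟨ regroup₁ t A B-1 C-1 i ⟩
    corner t + (B * C) * suc i         ≡⟨ cong (λ u → corner t + u * suc i) cassini ⟩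
    corner t + (A² + 1) * suc i        ≡⟨ regroup₂ (corner t) A² i ⟩
    corner t + suc i * A² + suc i      ∎))
    where
    open ≡-Reasoning
    v = progression t i
    regroup₁ : ∀ t a b c i → suc b * (t * a + c + suc c * i) + suc b ≡ t * a * suc b + (suc b * suc c) * suc i
    regroup₁ = solve-∀
    regroup₂ : ∀ s a i → s + (a + 1) * suc i ≡ s + suc i * a + suc i
    regroup₂ = solve-∀

  column-shift : ∀ t i → i < B →
    (corner t + B * A² + suc i * A²) / B² + 𝟙 (B ∣? progression t i) ≡ (corner t + suc i * A²) / B² + C
  column-shift t i i<B = begin
    (s + B * A² + suc i * A²) / B² + χ   ≡⟨ cong (λ u → u / B² + χ) shifted ⟩
    (B * (v + A²) + ρ) / B² + χ          ≡⟨ cong (_+ χ) ([n*w+r]/[n*n]≡w/n (v + A²) ρ ρ<B) ⟩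
    (v + A²) / B + χ                     ≡⟨ [v+a]/n+[n∣v]≡v/n+c B C A² v (sym cassini) ⟩
    v / B + C                            ≡⟨ cong (_+ C) ([n*w+r]/[n*n]≡w/n v ρ ρ<B) ⟨
    (B * v + ρ) / B² + C                 ≡⟨ cong (λ u → u / B² + C) (corner+[1+i]A²≡ t i i<B) ⟨
    (s + suc i * A²) / B² + C            ∎
    where
    open ≡-Reasoning
    s = corner t
    v = progression t i
    χ = 𝟙 (B ∣? v)
    ρ = B ∸ suc i
    ρ<B : ρ < B
    ρ<B = ℕ.∸-monoʳ-< (s≤s z≤n) i<B
    shifted : s + B * A² + suc i * A² ≡ B * (v + A²) + ρ
    shifted = begin
      s + B * A² + suc i * A²          ≡⟨ swap s (B * A²) (suc i * A²) ⟩
      s + suc i * A² + B * A²          ≡⟨ cong (_+ B * A²) (corner+[1+i]A²≡ t i i<B) ⟩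
      B * v + ρ + B * A²               ≡⟨ collect B v ρ A² ⟩
      B * (v + A²) + ρ                 ∎
      where
      swap : ∀ s k y → s + k + y ≡ s + y + k
      swap = solve-∀
      collect : ∀ b w r y → b * w + r + b * y ≡ b * (w + y) + r
      collect = solve-∀

  stripCount-shift : ∀ t → stripCount A² B² B (corner t + B * A²) ≡ stripCount A² B² B (corner t) + A²
  stripCount-shift t = ℕ.+-cancelʳ-≡ 1 _ _ (begin
    S (s + K) + 1                                                      ≡⟨ cong (S (s + K) +_) (∑-𝟙-∣-linear B⊥C (t * A + C-1)) ⟨
    S (s + K) + ∑[ i < B ] 𝟙 (B ∣? v i)                                ≡⟨ ∑-+ B _ (λ i → 𝟙 (B ∣? v i)) ⟨
    ∑[ i < B ] suc ((s + K + suc i * A²) / B² + 𝟙 (B ∣? v i))          ≡⟨ ∑-cong B (λ i i<B → cong suc (column-shift t i i<B)) ⟩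
    ∑[ i < B ] (suc ((s + suc i * A²) / B²) + C)                       ≡⟨ ∑-+ B _ (λ _ → C) ⟩
    S s + ∑[ i < B ] C                                                 ≡⟨ cong (S s +_) (trans (∑-const B C) cassini) ⟩
    S s + (A² + 1)                                                     ≡⟨ ℕ.+-assoc _ A² 1 ⟨
    S s + A² + 1                                                       ∎)
    where
    open ≡-Reasoning
    S = stripCount A² B² B
    s = corner t
    K = B * A²
    v = progression t

  count : ℕ → ℕ
  count t = triangleCount A² B² (corner t)

  count-recurrence : ∀ t → count (t + A + A) + count t ≡ count (t + A) + count (t + A) + A²
  count-recurrence t = begin
    count (t + A + A) + count t                           ≡⟨ cong (λ u → triangleCount A² B² u + count t) (trans (corner-+A (t + A)) (cong (_+ K) (corner-+A t))) ⟩
    T (s + K + K) + T s                                   ≡⟨ cong (_+ T s) (triangleCount-+ A² B² B (s + K)) ⟩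
    S (s + K) + T (s + K) + T s                           ≡⟨ cong (λ u → u + T (s + K) + T s) (stripCount-shift t) ⟩
    S s + A² + T (s + K) + T s                            ≡⟨ regroup (S s) A² (T (s + K)) (T s) ⟩
    T (s + K) + (S s + T s) + A²                          ≡⟨ cong (λ u → T (s + K) + u + A²) (triangleCount-+ A² B² B s) ⟨
    T (s + K) + T (s + K) + A²                            ≡⟨ cong (λ u → triangleCount A² B² u + triangleCount A² B² u + A²) (corner-+A t) ⟨
    count (t + A) + count (t + A) + A²                    ∎
    where
    open ≡-Reasoning
    T = triangleCount A² B²
    S = stripCount A² B² B
    s = corner t
    K = B * A²
    regroup : ∀ x a h g → x + a + h + g ≡ h + (x + g) + a
    regroup = solve-∀

  quasiPeriod : IsQuasiPeriod count A
  quasiPeriod = secondDifference⇒quasiPeriod count A A² count-recurrence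

latticeCount≡triangleCount : ∀ A B .{{_ : NonZero A}} .{{_ : NonZero B}} t →
  latticeCount A B t ≡ triangleCount (A * A) (B * B) (t * A * B)
latticeCount≡triangleCount A B t =
  trans (latticeCount≡boxCount A B t) (boxCount≡triangleCount (A * A) (B * B) (t * A * B) _ ℕ.≤-refl)

latticeCount-flip≡triangleCount : ∀ A B .{{_ : NonZero A}} .{{_ : NonZero B}} t →
  latticeCount B A t ≡ triangleCount (A * A) (B * B) (t * A * B)
latticeCount-flip≡triangleCount A B t = begin
  latticeCount B A t                                   ≡⟨ latticeCount≡boxCount B A t ⟩
  boxCount (B * B) (A * A) (t * B * A) n               ≡⟨ boxCount-comm (B * B) (A * A) (t * B * A) n ⟩
  boxCount (A * A) (B * B) (t * B * A) n               ≡⟨ boxCount≡triangleCount (A * A) (B * B) (t * B * A) n ℕ.≤-refl ⟩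
  triangleCount (A * A) (B * B) (t * B * A)            ≡⟨ cong (triangleCount (A * A) (B * B)) (swap t B A) ⟩
  triangleCount (A * A) (B * B) (t * A * B)            ∎
  where
  open ≡-Reasoning
  n = suc (t * B * A)
  swap : ∀ t b a → t * b * a ≡ t * a * b
  swap = solve-∀

cassini⇒quasiPeriod : ∀ A B C .{{_ : NonZero A}} .{{_ : NonZero B}} .{{_ : NonZero C}} →
  B * C ≡ A * A + 1 → Coprime B C →
  IsQuasiPeriod (latticeCount A B) A × IsQuasiPeriod (latticeCount C A) A
cassini⇒quasiPeriod A@(suc A-1) B@(suc B-1) C@(suc C-1) BC≡A²+1 B⊥C =
  IsQuasiPeriod-cong (latticeCount≡triangleCount A B) (CassiniTriangle.quasiPeriod A-1 B-1 C-1 BC≡A²+1 B⊥C) ,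
  IsQuasiPeriod-cong (latticeCount-flip≡triangleCount A C)
    (CassiniTriangle.quasiPeriod A-1 C-1 B-1 (trans (ℕ.*-comm C B) BC≡A²+1) (Coprime.sym B⊥C))

module _ (k : ℕ) where

  kFib-pos : 1 ≤ k → ∀ n → 0 < kFib k (suc n)
  kFib-pos 1≤k zero    = s≤s z≤n
  kFib-pos 1≤k (suc n) = ℕ.≤-trans (ℕ.*-mono-≤ 1≤k (kFib-pos 1≤k n)) (ℕ.m≤m+n (k * kFib k (suc n)) (kFib k n))

  kFib-coprime-suc : ∀ n → Coprime (kFib k n) (kFib k (suc n))
  kFib-coprime-suc zero    (_ , d∣1) = ∣1⇒≡1 d∣1
  kFib-coprime-suc (suc n) (d∣F₁ , d∣F₂) = kFib-coprime-suc n (∣m+n∣m⇒∣n d∣F₂ (∣n⇒∣m*n k d∣F₁) , d∣F₁)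

  kFib-coprime-+2 : ∀ n → Coprime (kFib k n) k → Coprime (kFib k n) (kFib k (2 + n))
  kFib-coprime-+2 n Fₙ⊥k {d} (d∣F₀ , d∣F₂) = Fₙ⊥k (d∣F₀ , coprime-divisor d⊥F₁ d∣F₁k)
    where
    F₀ = kFib k n
    F₁ = kFib k (suc n)
    d∣F₁k : d ∣ F₁ * k
    d∣F₁k = subst (d ∣_) (ℕ.*-comm k F₁) (∣m+n∣m⇒∣n (subst (d ∣_) (ℕ.+-comm (k * F₁) F₀) d∣F₂) d∣F₀)
    d⊥F₁ : Coprime d F₁
    d⊥F₁ (e∣d , e∣F₁) = kFib-coprime-suc n (∣-trans e∣d d∣F₀ , e∣F₁)

  kFib-odd≡1-mod-k : ∀ j → ∃[ q ] kFib k (suc (j * 2)) ≡ 1 + k * q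
  kFib-odd≡1-mod-k zero    = 0 , cong suc (sym (ℕ.*-zeroʳ k))
  kFib-odd≡1-mod-k (suc j) with kFib-odd≡1-mod-k j
  ... | q , F≡1+kq = kFib k (2 + j * 2) + q , trans (cong (k * kFib k (2 + j * 2) +_) F≡1+kq) (regroup k (kFib k (2 + j * 2)) q)
    where
    regroup : ∀ k f q → k * f + (1 + k * q) ≡ 1 + k * (f + q)
    regroup = solve-∀

  kFib-odd-coprime : ∀ j → Coprime (kFib k (suc (j * 2))) k
  kFib-odd-coprime j {d} (d∣F , d∣k) with kFib-odd≡1-mod-k j
  ... | q , F≡1+kq = ∣1⇒≡1 (∣m+n∣m⇒∣n (subst (d ∣_) (trans F≡1+kq (ℕ.+-comm 1 (k * q))) d∣F) (∣m⇒∣m*n q d∣k))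

  -- The Cassini defect F m · F (m+2) − F (m+1)² changes sign at each step; stated without subtraction.
  kFib-cassini-step : ∀ m → kFib k (1 + m) * kFib k (3 + m) + kFib k m * kFib k (2 + m)
                          ≡ kFib k (2 + m) * kFib k (2 + m) + kFib k (1 + m) * kFib k (1 + m)
  kFib-cassini-step m = expand k (kFib k m) (kFib k (suc m))
    where
    expand : ∀ k a b → b * (k * (k * b + a) + b) + a * (k * b + a) ≡ (k * b + a) * (k * b + a) + b * b
    expand = solve-∀

  mutual
    kFib-cassini-odd : ∀ j → kFib k (1 + j * 2) * kFib k (1 + j * 2) ≡ kFib k (j * 2) * kFib k (2 + j * 2) + 1
    kFib-cassini-odd zero    = refl
    kFib-cassini-odd (suc j) = ℕ.+-cancelʳ-≡ (F₂ * F₂) _ _ (begin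
      F₃ * F₃ + F₂ * F₂                 ≡⟨ kFib-cassini-step (1 + j * 2) ⟨
      F₂ * F₄ + F₁ * F₃                 ≡⟨ cong (F₂ * F₄ +_) (kFib-cassini-even j) ⟩
      F₂ * F₄ + (F₂ * F₂ + 1)           ≡⟨ regroup (F₂ * F₄) (F₂ * F₂) ⟩
      F₂ * F₄ + 1 + F₂ * F₂             ∎)
      where
      open ≡-Reasoning
      F₁ = kFib k (1 + j * 2)
      F₂ = kFib k (2 + j * 2)
      F₃ = kFib k (3 + j * 2)
      F₄ = kFib k (4 + j * 2)
      regroup : ∀ x y → x + (y + 1) ≡ x + 1 + y
      regroup = solve-∀

    kFib-cassini-even : ∀ j → kFib k (1 + j * 2) * kFib k (3 + j * 2) ≡ kFib k (2 + j * 2) * kFib k (2 + j * 2) + 1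
    kFib-cassini-even j = ℕ.+-cancelʳ-≡ (F₀ * F₂) _ _ (begin
      F₁ * F₃ + F₀ * F₂                 ≡⟨ kFib-cassini-step (j * 2) ⟩
      F₂ * F₂ + F₁ * F₁                 ≡⟨ cong (F₂ * F₂ +_) (kFib-cassini-odd j) ⟩
      F₂ * F₂ + (F₀ * F₂ + 1)           ≡⟨ regroup (F₂ * F₂) (F₀ * F₂) ⟩
      F₂ * F₂ + 1 + F₀ * F₂             ∎)
      where
      open ≡-Reasoning
      F₀ = kFib k (j * 2)
      F₁ = kFib k (1 + j * 2)
      F₂ = kFib k (2 + j * 2)
      F₃ = kFib k (3 + j * 2)
      regroup : ∀ x y → x + (y + 1) ≡ x + 1 + y
      regroup = solve-∀

theorem3p2 : (k : ℕ) → 1 ≤ k → (n : ℕ) → 2 ≤ n → 2 ∣ n →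
    IsQuasiPeriod (ehrhartI k n) (kFib k n) × IsQuasiPeriod (ehrhartI k (suc n)) (kFib k n)
theorem3p2 k 1≤k n 2≤n (divides zero n≡0) = contradiction (subst (2 ≤_) n≡0 2≤n) λ ()
theorem3p2 k 1≤k .(suc j * 2) _ (divides (suc j) refl) =
  cassini⇒quasiPeriod (kFib k (2 + j * 2)) (kFib k (1 + j * 2)) (kFib k (3 + j * 2))
    {{nonZero (1 + j * 2)}} {{nonZero (j * 2)}} {{nonZero (2 + j * 2)}}
    (kFib-cassini-even k j) (kFib-coprime-+2 k (1 + j * 2) (kFib-odd-coprime k j))
  where
  nonZero : ∀ m → NonZero (kFib k (suc m))
  nonZero m = ℕ.>-nonZero (kFib-pos k 1≤k m)
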